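{- Consider the distributed peeling protocol described below run in synchronized phases. Then: (i) for $k$-core mining on a graph $G=(V,E)$ (threshold $k(v)=k$ for all nodes) with $k\le |V|$, the protocol converges in no more than $|V|-k$ phases; (ii) for $(k_1,k_2)$-core mining on a bipartite graph $G=(V_1,V_2,E)$ (threshold $k(v)=k_i$ for $v\in V_i$), it converges in no more than $(|V_1|-k_2)+(|V_2|-k_1)+1$ phases; (iii) for $(k_1,\ldots,k_p)$-core mining on a $p$-partite graph $G=(V_1,\ldots,V_p,E)$ (threshold $k(v)=k_i$ for $v\in V_i$) with $k_i\le |V_i|$ for all $1\le i\le p$, it converges in no more than $\sum_{i=1}^{p}|V_i|-\min_{1\le i\le p}k_i$ phases.
   Context: A $p$-partite graph $G=(V_1,\ldots,V_p,E)$ has its vertex set partitioned into disjoint sets $V_1,\ldots,V_p$ with no edge inside any $V_i$ (bipartite means $p=2$). Distributed peeling protocol with thresholds $k(v)$: each node $v$ keeps a counter $degree$, initially $\deg_G(v)$, and a status, initially active. Initially (onInitial), if $degree<k(v)$, node $v$ sends an ``off'' message to each of its neighbors and becomes inactive. Whenever an active node $v$ receives an off message (onMessage), it decreases $degree$ by $1$, and if now $degree<k(v)$, it sends an off message to each of its neighbors and becomes inactive. An inactive node stays inactive and ignores all incoming messages. Synchronized phases: in each phase, every node receives all messages sent by other nodes in the previous phase, processes them, and, if applicable, sends off messages to all its neighbors; the first phase executes onInitial. The protocol converges at the last phase in which any node is set inactive (after which no further messages are sent). -}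

module Defs where

open import Data.Nat using (ℕ; zero; suc; _+_; _≤ᵇ_; _⊓_; _<_)
open import Data.Bool using (Bool; true; false; _∧_; if_then_else_)
open import Data.Fin using (Fin; zero; suc; _≟_)
open import Relation.Nullary.Decidable using (⌊_⌋)
open import Relation.Binary.PropositionalEquality using (_≡_; _≢_)
open import Function using (_∘_)
open import Data.Product using (_×_)

record Graph (n : ℕ) : Set where
  field
    adj    : Fin n → Fin n → Bool
    sym    : ∀ u v → adj u v ≡ adj v u
    irrefl : ∀ v → adj v v ≡ false
open Graph public

countB : ∀ {n} → (Fin n → Bool) → ℕ
countB {zero}  f = 0
countB {suc n} f = (if f zero then 1 else 0) + countB (f ∘ suc)

sumF : ∀ {p} → (Fin p → ℕ) → ℕ
sumF {zero}  f = 0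
sumF {suc p} f = f zero + sumF (f ∘ suc)

minF : ∀ {q} → (Fin (suc q) → ℕ) → ℕ
minF {zero}  f = f zero
minF {suc q} f = f zero ⊓ minF (f ∘ suc)

deg : ∀ {n} → Graph n → Fin n → ℕ
deg G v = countB (λ u → adj G v u)

-- Phases are numbered 0,1,2,... ; phase 0 executes onInitial.
-- alive G k t v = "v is active at the start of phase t" (= after phase t-1).
-- At phase t an active node's counter equals the number of its neighbours
-- active at the start of phase t (it has received all off messages sent in
-- phases 0..t-1), and it becomes inactive iff this counter is < k v.
alive : ∀ {n} → Graph n → (Fin n → ℕ) → ℕ → Fin n → Bool
alive G k zero    v = true
alive G k (suc t) v =
  alive G k t v ∧ (k v ≤ᵇ countB (λ u → adj G v u ∧ alive G k t u))

setInactiveAt : ∀ {n} → Graph n → (Fin n → ℕ) → ℕ → Fin n → Set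
setInactiveAt G k t v = (alive G k t v ≡ true) × (alive G k (suc t) v ≡ false)


ConvergesWithin : ∀ {n} → Graph n → (Fin n → ℕ) → ℕ → Set
ConvergesWithin G k B = ∀ t v → B < t → alive G k t v ≡ true → alive G k (suc t) v ≡ true

IsPartite : ∀ {n p} → Graph n → (Fin n → Fin p) → Set
IsPartite G part = ∀ u v → adj G u v ≡ true → part u ≢ part v

partSize : ∀ {n p} → (Fin n → Fin p) → Fin p → ℕ
partSize part i = countB (λ v → ⌊ part v ≟ i ⌋)

pair : ℕ → ℕ → Fin 2 → ℕ
pair k₁ k₂ zero       = k₁
pair k₁ k₂ (suc zero) = k₂

-- A node deactivated in phase t + 1 has a neighbour deactivated in phase t, since otherwise
-- its counter would not have dropped. Hence a deactivation in phase t ends a chain of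
-- deactivations of adjacent nodes, one per phase, each shrinking the active set; the last
-- node v still had k(v) active neighbours besides itself in phase t − 1, so t + k(v) ≤ |V|,
-- which gives (i) and (iii). In a bipartite graph the chain alternates sides, so t is bounded
-- by |V₁| + |V₂| minus the nodes active on v's side in phase t − 2 and on the other side in
-- phase t − 1. The latter are at least k(v), as v survived phase t − 1; the former exceed the
-- threshold of the other side, because some neighbour of v survived phase t − 1 without being
-- adjacent to the chain node w of phase t − 2 (otherwise v would have had fewer active
-- neighbours than w, which has the same threshold).
module Submission where

open import Defs hiding (sym)
open import Data.Nat as N using ()
open import Data.Nat using (ℕ; zero; suc; _+_; _∸_; _≤_; _<_; _≤ᵇ_; z≤n; s≤s)
open import Data.Nat.Properties hiding (_≟_)
open import Data.Bool using (Bool; true; false; _∧_; if_then_else_; T)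
open import Data.Bool.Properties using (∧-conicalˡ; ∧-conicalʳ)
open import Data.Unit using (tt)
open import Data.Fin using (Fin; zero; suc; _≟_; opposite)
open import Data.Fin.Properties using (opposite-involutive)
open import Data.Product using (_×_; _,_; proj₁; ∃)
open import Data.Sum using (_⊎_; inj₁; inj₂)
open import Data.Empty using (⊥-elim)
open import Relation.Nullary using (¬_)
open import Relation.Nullary.Decidable using (⌊_⌋; isYes≗does; dec-true; ⌊⌋-map′)
open import Relation.Binary.PropositionalEquality
  using (_≡_; _≢_; refl; sym; trans; cong; cong₂; subst; module ≡-Reasoning)
open import Function using (_∘_)
open import Algebra.Properties.CommutativeSemigroup +-commutativeSemigroup using (interchange)

∧-false⇒falseʳ : ∀ {a b} → a ≡ true → a ∧ b ≡ false → b ≡ false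
∧-false⇒falseʳ refl e = e

∧-false⇒falseˡ : ∀ {a b} → b ≡ true → a ∧ b ≡ false → a ≡ false
∧-false⇒falseˡ {false} _    _ = refl
∧-false⇒falseˡ {true}  refl e = e

≤ᵇ-true⇒≤ : ∀ {m n} → (m ≤ᵇ n) ≡ true → m ≤ n
≤ᵇ-true⇒≤ {m} {n} e = ≤ᵇ⇒≤ m n (subst T (sym e) tt)

≤ᵇ-false⇒> : ∀ {m n} → (m ≤ᵇ n) ≡ false → n < m
≤ᵇ-false⇒> e = ≰⇒> (λ m≤n → subst T e (≤⇒≤ᵇ m≤n))

indicator : Bool → ℕ
indicator b = if b then 1 else 0

indicator-mono : ∀ a b → (a ≡ true → b ≡ true) → indicator a ≤ indicator b
indicator-mono false _ _ = z≤n
indicator-mono true  b h rewrite h refl = ≤-refl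

indicator≤1 : ∀ a → indicator a ≤ 1
indicator≤1 false = z≤n
indicator≤1 true  = ≤-refl

infix 4 _⊆ᵇ_
_⊆ᵇ_ : ∀ {n} → (Fin n → Bool) → (Fin n → Bool) → Set
f ⊆ᵇ g = ∀ u → f u ≡ true → g u ≡ true

countB-mono : ∀ {n} (f g : Fin n → Bool) → f ⊆ᵇ g → countB f ≤ countB g
countB-mono {zero}  f g f⊆g = z≤n
countB-mono {suc n} f g f⊆g =
  +-mono-≤ (indicator-mono (f zero) (g zero) (f⊆g zero))
           (countB-mono (f ∘ suc) (g ∘ suc) (f⊆g ∘ suc))

countB-mono-< : ∀ {n} (f g : Fin n → Bool) → f ⊆ᵇ g →
                (w : Fin n) → g w ≡ true → f w ≡ false → countB f < countB g
countB-mono-< f g f⊆g zero gw fw rewrite gw | fw =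
  s≤s (countB-mono (f ∘ suc) (g ∘ suc) (f⊆g ∘ suc))
countB-mono-< f g f⊆g (suc w) gw fw =
  subst (_≤ indicator (g zero) + countB (g ∘ suc)) (+-suc (indicator (f zero)) _)
    (+-mono-≤ (indicator-mono (f zero) (g zero) (f⊆g zero))
              (countB-mono-< (f ∘ suc) (g ∘ suc) (f⊆g ∘ suc) w gw fw))

countB≤n : ∀ {n} (f : Fin n → Bool) → countB f ≤ n
countB≤n {zero}  f = z≤n
countB≤n {suc n} f = +-mono-≤ (indicator≤1 (f zero)) (countB≤n (f ∘ suc))

⇒-or-counterexample : ∀ a b → (a ≡ true → b ≡ true) ⊎ (a ≡ true × b ≡ false)
⇒-or-counterexample false _     = inj₁ λ ()
⇒-or-counterexample true  true  = inj₁ λ _ → refl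
⇒-or-counterexample true  false = inj₂ (refl , refl)

⊆ᵇ-or-counterexample : ∀ {n} (f g : Fin n → Bool) →
                       f ⊆ᵇ g ⊎ ∃ λ u → f u ≡ true × g u ≡ false
⊆ᵇ-or-counterexample {zero}  f g = inj₁ λ ()
⊆ᵇ-or-counterexample {suc n} f g
  with ⇒-or-counterexample (f zero) (g zero) | ⊆ᵇ-or-counterexample (f ∘ suc) (g ∘ suc)
... | inj₂ (fz , gz) | _                  = inj₂ (zero , fz , gz)
... | inj₁ _         | inj₂ (u , fu , gu) = inj₂ (suc u , fu , gu)
... | inj₁ h₀        | inj₁ h             = inj₁ λ { zero → h₀ ; (suc u) → h u }

sumF-+ : ∀ {p} (a b : Fin p → ℕ) → sumF (λ i → a i + b i) ≡ sumF a + sumF b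
sumF-+ {zero}  a b = refl
sumF-+ {suc p} a b rewrite sumF-+ (a ∘ suc) (b ∘ suc) =
  interchange (a zero) (b zero) (sumF (a ∘ suc)) (sumF (b ∘ suc))

sumF-cong : ∀ {p} {a b : Fin p → ℕ} → (∀ i → a i ≡ b i) → sumF a ≡ sumF b
sumF-cong {zero}  a≗b = refl
sumF-cong {suc p} a≗b = cong₂ _+_ (a≗b zero) (sumF-cong (a≗b ∘ suc))

sumF-0 : ∀ p → sumF {p} (λ _ → 0) ≡ 0
sumF-0 zero    = refl
sumF-0 (suc p) = sumF-0 p

sumF-indicator-≟ : ∀ {p} (a : Fin p) → sumF (λ i → indicator ⌊ a ≟ i ⌋) ≡ 1
sumF-indicator-≟ {suc p} zero    = cong suc (sumF-0 p)
-- ⌊_⌋ does not compute through the map′ in the successor case of _≟_.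
sumF-indicator-≟ {suc p} (suc a) =
  trans (sumF-cong (λ i → cong indicator (⌊⌋-map′ _ _ (a ≟ i)))) (sumF-indicator-≟ a)

sumF-partSize : ∀ {n p} (part : Fin n → Fin p) → sumF (partSize part) ≡ n
sumF-partSize {zero} {p} part = sumF-0 p
sumF-partSize {suc n} part = begin
  sumF (partSize part)
    ≡⟨ sumF-+ _ (partSize (part ∘ suc)) ⟩
  sumF (λ i → indicator ⌊ part zero ≟ i ⌋) + sumF (partSize (part ∘ suc))
    ≡⟨ cong₂ _+_ (sumF-indicator-≟ (part zero)) (sumF-partSize (part ∘ suc)) ⟩
  suc n
    ∎
  where open ≡-Reasoning

minF≤ : ∀ {q} (ks : Fin (suc q) → ℕ) i → minF ks ≤ ks i
minF≤ {zero}  ks zero    = ≤-refl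
minF≤ {suc q} ks zero    = m⊓n≤m _ _
minF≤ {suc q} ks (suc i) = ≤-trans (m⊓n≤n (ks zero) _) (minF≤ (ks ∘ suc) i)

m+[a+b]≤c+d⇒m≤[c∸a]+[d∸b] : ∀ m {a b c d} →
  m + (a + b) ≤ c + d → a ≤ c → b ≤ d → m ≤ (c ∸ a) + (d ∸ b)
m+[a+b]≤c+d⇒m≤[c∸a]+[d∸b] m {a} {b} {c} {d} le a≤c b≤d = begin
  m                   ≤⟨ m+n≤o⇒m≤o∸n m le ⟩
  (c + d) ∸ (a + b)   ≡⟨ ∸-+-assoc (c + d) a b ⟨
  (c + d) ∸ a ∸ b     ≡⟨ cong (_∸ b) (+-∸-comm d a≤c) ⟩
  ((c ∸ a) + d) ∸ b   ≡⟨ +-∸-assoc (c ∸ a) b≤d ⟩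
  (c ∸ a) + (d ∸ b)   ∎
  where open ≤-Reasoning

⌊≟⌋-true : ∀ {p} {i j : Fin p} → i ≡ j → ⌊ i ≟ j ⌋ ≡ true
⌊≟⌋-true {i = i} {j} i≡j = trans (isYes≗does (i ≟ j)) (dec-true (i ≟ j) i≡j)

opposite-swap : ∀ {p} {i j : Fin p} → i ≡ opposite j → j ≡ opposite i
opposite-swap {j = j} refl = sym (opposite-involutive j)

≢⇒≡opposite : ∀ {i j : Fin 2} → i ≢ j → i ≡ opposite j
≢⇒≡opposite {zero}     {zero}     i≢j = ⊥-elim (i≢j refl)
≢⇒≡opposite {zero}     {suc zero} _   = refl
≢⇒≡opposite {suc zero} {zero}     _   = refl
≢⇒≡opposite {suc zero} {suc zero} i≢j = ⊥-elim (i≢j refl)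

module Peeling {n} (G : Graph n) (k : Fin n → ℕ) where

  liveDeg : ℕ → Fin n → ℕ
  liveDeg s v = countB (λ u → adj G v u ∧ alive G k s u)

  liveCount : ℕ → ℕ
  liveCount s = countB (alive G k s)

  alive-suc⇒alive : ∀ s {v} → alive G k (suc s) v ≡ true → alive G k s v ≡ true
  alive-suc⇒alive s = ∧-conicalˡ _ _

  alive-suc⇒k≤liveDeg : ∀ s {v} → alive G k (suc s) v ≡ true → k v ≤ liveDeg s v
  alive-suc⇒k≤liveDeg s = ≤ᵇ-true⇒≤ ∘ ∧-conicalʳ _ _

  setInactive⇒liveDeg<k : ∀ s {v} → setInactiveAt G k s v → liveDeg s v < k v
  setInactive⇒liveDeg<k s (on , off) = ≤ᵇ-false⇒> (∧-false⇒falseʳ on off)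

  liveDeg<liveCount : ∀ s {v} → alive G k s v ≡ true → liveDeg s v < liveCount s
  liveDeg<liveCount s {v} on =
    countB-mono-< _ (alive G k s) (λ u → ∧-conicalʳ (adj G v u) _) v on
      (cong (_∧ alive G k s v) (irrefl G v))

  liveCount-setInactive : ∀ s {v} → setInactiveAt G k s v → liveCount (suc s) < liveCount s
  liveCount-setInactive s {v} (on , off) =
    countB-mono-< (alive G k (suc s)) (alive G k s) (λ _ → alive-suc⇒alive s) v on off

  setInactive-suc⇒neighbour-setInactive : ∀ s {v} → setInactiveAt G k (suc s) v →
    ∃ λ u → adj G v u ≡ true × setInactiveAt G k s u
  setInactive-suc⇒neighbour-setInactive s {v} r@(on , _)
    with ⊆ᵇ-or-counterexample (λ u → adj G v u ∧ alive G k s u)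
                              (λ u → adj G v u ∧ alive G k (suc s) u)
  ... | inj₁ h = ⊥-elim (<⇒≱ (setInactive⇒liveDeg<k (suc s) r)
                   (≤-trans (alive-suc⇒k≤liveDeg s on) (countB-mono _ _ h)))
  ... | inj₂ (u , on-u , off-u) =
    u , adj-vu , ∧-conicalʳ _ _ on-u , ∧-false⇒falseʳ adj-vu off-u
    where adj-vu = ∧-conicalˡ _ _ on-u

  phase+liveCount≤n : ∀ s {v} → setInactiveAt G k s v → s + liveCount s ≤ n
  phase+liveCount≤n zero    _ = countB≤n _
  phase+liveCount≤n (suc s) r with setInactive-suc⇒neighbour-setInactive s r
  ... | _ , _ , r′ = begin
    suc s + liveCount (suc s)   ≡⟨ +-suc s _ ⟨
    s + suc (liveCount (suc s)) ≤⟨ +-monoʳ-≤ s (liveCount-setInactive s r′) ⟩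
    s + liveCount s             ≤⟨ phase+liveCount≤n s r′ ⟩
    n                           ∎
    where open ≤-Reasoning

  phase+k≤n : ∀ s {v} → setInactiveAt G k (suc s) v → suc s + k v ≤ n
  phase+k≤n s {v} r@(on , _) with setInactive-suc⇒neighbour-setInactive s r
  ... | _ , _ , r′ = begin
    suc s + k v           ≡⟨ +-suc s _ ⟨
    s + suc (k v)         ≤⟨ +-monoʳ-≤ s (s≤s (alive-suc⇒k≤liveDeg s on)) ⟩
    s + suc (liveDeg s v) ≤⟨ +-monoʳ-≤ s (liveDeg<liveCount s (alive-suc⇒alive s on)) ⟩
    s + liveCount s       ≤⟨ phase+liveCount≤n s r′ ⟩
    n                     ∎
    where open ≤-Reasoning

  convergesWithin-of-¬setInactive : ∀ B → (∀ t v → B < t → ¬ setInactiveAt G k t v) →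
                                    ConvergesWithin G k B
  convergesWithin-of-¬setInactive B quiet t v B<t on with alive G k (suc t) v in off
  ... | true  = refl
  ... | false = ⊥-elim (quiet t v B<t (on , off))

  convergesWithin-n∸k : ∀ B → (∀ v → n ∸ k v ≤ B) → ConvergesWithin G k B
  convergesWithin-n∸k B n∸k≤B = convergesWithin-of-¬setInactive B quiet
    where
      quiet : ∀ t v → B < t → ¬ setInactiveAt G k t v
      quiet (suc s) v B<t r =
        <⇒≱ B<t (≤-trans (m+n≤o⇒m≤o∸n (suc s) (phase+k≤n s r)) (n∸k≤B v))

  survivor-neighbour-not-adjacent : ∀ s {v w} → setInactiveAt G k s w →
    alive G k (suc (suc s)) v ≡ true → k w ≤ k v →
    ∃ λ y → adj G v y ≡ true × alive G k (suc s) y ≡ true × adj G w y ≡ false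
  survivor-neighbour-not-adjacent s {v} {w} r on kw≤kv
    with ⊆ᵇ-or-counterexample (λ y → adj G v y ∧ alive G k (suc s) y)
                              (λ y → adj G w y ∧ alive G k s y)
  ... | inj₁ h = ⊥-elim (<⇒≱ (setInactive⇒liveDeg<k s r)
    (≤-trans kw≤kv (≤-trans (alive-suc⇒k≤liveDeg (suc s) on) (countB-mono _ _ h))))
  ... | inj₂ (y , on-y , off-y) =
    y , ∧-conicalˡ _ _ on-y , alive-y , ∧-false⇒falseˡ (alive-suc⇒alive s alive-y) off-y
    where alive-y = ∧-conicalʳ (adj G v y) _ on-y

module Bipartite {n} (G : Graph n) (part : Fin n → Fin 2) (bip : IsPartite G part)
                 (κ : Fin 2 → ℕ) where

  k : Fin n → ℕ
  k = κ ∘ part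

  open Peeling G k

  P : Fin 2 → ℕ
  P = partSize part

  neighbour-opposite : ∀ {v u} → adj G v u ≡ true → part u ≡ opposite (part v)
  neighbour-opposite {v} {u} vu = ≢⇒≡opposite (λ e → bip v u vu (sym e))

  partSize+partSize-opposite : ∀ i → P i + P (opposite i) ≡ n
  partSize+partSize-opposite zero       =
    trans (cong (P zero +_) (sym (+-identityʳ _))) (sumF-partSize part)
  partSize+partSize-opposite (suc zero) =
    trans (+-comm (P (suc zero)) _) (partSize+partSize-opposite zero)

  liveAt : Fin 2 → ℕ → Fin n → Bool
  liveAt i s x = ⌊ part x ≟ i ⌋ ∧ alive G k s x

  liveIn : Fin 2 → ℕ → ℕ
  liveIn i s = countB (liveAt i s)

  liveAt-suc⊆ : ∀ i s → liveAt i (suc s) ⊆ᵇ liveAt i s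
  liveAt-suc⊆ i s x on =
    cong₂ _∧_ (∧-conicalˡ _ _ on)
              (alive-suc⇒alive s (∧-conicalʳ ⌊ part x ≟ i ⌋ _ on))

  liveIn≤partSize : ∀ i s → liveIn i s ≤ P i
  liveIn≤partSize i s = countB-mono (liveAt i s) _ (λ x → ∧-conicalˡ _ _)

  liveIn-suc≤ : ∀ i s → liveIn i (suc s) ≤ liveIn i s
  liveIn-suc≤ i s = countB-mono _ _ (liveAt-suc⊆ i s)

  liveIn-setInactive : ∀ s {y} → setInactiveAt G k s y →
                       liveIn (part y) (suc s) < liveIn (part y) s
  liveIn-setInactive s {y} (on , off) =
    countB-mono-< _ _ (liveAt-suc⊆ (part y) s) y
      (cong₂ _∧_ own-side on) (trans (cong (_∧ alive G k (suc s) y) own-side) off)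
    where own-side = ⌊≟⌋-true refl

  neighbours⊆liveAt-opposite : ∀ s v →
    (λ u → adj G v u ∧ alive G k s u) ⊆ᵇ liveAt (opposite (part v)) s
  neighbours⊆liveAt-opposite s v u on =
    cong₂ _∧_ (⌊≟⌋-true (neighbour-opposite (∧-conicalˡ _ _ on)))
              (∧-conicalʳ (adj G v u) _ on)

  liveDeg≤liveIn-opposite : ∀ s v → liveDeg s v ≤ liveIn (opposite (part v)) s
  liveDeg≤liveIn-opposite s v = countB-mono _ _ (neighbours⊆liveAt-opposite s v)

  liveDeg<liveIn-opposite : ∀ s {v w} → part w ≡ opposite (part v) →
    alive G k s w ≡ true → adj G v w ≡ false → liveDeg s v < liveIn (opposite (part v)) s
  liveDeg<liveIn-opposite s {v} {w} side on vw =
    countB-mono-< _ _ (neighbours⊆liveAt-opposite s v) w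
      (cong₂ _∧_ (⌊≟⌋-true side) on) (cong (_∧ alive G k s w) vw)

  -- A chain of deactivations alternates sides, so along a chain ending on side i at phase s
  -- the nodes not yet consumed are those active on side i at phase s and those active on the
  -- other side one phase later.
  potential : Fin 2 → ℕ → ℕ
  potential i s = liveIn i s + liveIn (opposite i) (suc s)

  potential-setInactive : ∀ s {y} → setInactiveAt G k s y →
                          potential (opposite (part y)) (suc s) < potential (part y) s
  potential-setInactive s {y} r = begin-strict
    liveIn (opposite j) (suc s) + liveIn (opposite (opposite j)) (suc (suc s))
      ≡⟨ cong (λ i → liveIn (opposite j) (suc s) + liveIn i (suc (suc s)))
              (opposite-involutive j) ⟩
    liveIn (opposite j) (suc s) + liveIn j (suc (suc s))
      ≡⟨ +-comm (liveIn (opposite j) (suc s)) _ ⟩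
    liveIn j (suc (suc s)) + liveIn (opposite j) (suc s)
      <⟨ +-monoˡ-< _ (≤-<-trans (liveIn-suc≤ j (suc s)) (liveIn-setInactive s r)) ⟩
    liveIn j s + liveIn (opposite j) (suc s)
      ∎
    where
      j = part y
      open ≤-Reasoning

  phase+potential≤n : ∀ s {x} → setInactiveAt G k s x → s + potential (part x) s ≤ n
  phase+potential≤n zero {x} _ = ≤-trans
    (+-mono-≤ (liveIn≤partSize (part x) 0) (liveIn≤partSize (opposite (part x)) 1))
    (≤-reflexive (partSize+partSize-opposite (part x)))
  phase+potential≤n (suc s) {x} r with setInactive-suc⇒neighbour-setInactive s r
  ... | y , xy , r′ = begin
    suc s + potential (part x) (suc s)
      ≡⟨ cong (λ i → suc s + potential i (suc s)) x-side ⟩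
    suc s + potential (opposite (part y)) (suc s)
      ≡⟨ +-suc s _ ⟨
    s + suc (potential (opposite (part y)) (suc s))
      ≤⟨ +-monoʳ-≤ s (potential-setInactive s r′) ⟩
    s + potential (part y) s
      ≤⟨ phase+potential≤n s r′ ⟩
    n
      ∎
    where
      x-side = neighbour-opposite (trans (Graph.sym G y x) xy)
      open ≤-Reasoning

  κ≤liveIn-opposite : ∀ s {v} → alive G k (suc s) v ≡ true →
                      κ (part v) ≤ liveIn (opposite (part v)) s
  κ≤liveIn-opposite s {v} on =
    ≤-trans (alive-suc⇒k≤liveDeg s on) (liveDeg≤liveIn-opposite s v)

  κ-opposite<liveIn : ∀ s {v w} → setInactiveAt G k s w → alive G k (suc (suc s)) v ≡ true →
                      part w ≡ part v → κ (opposite (part v)) < liveIn (part v) s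
  κ-opposite<liveIn s {v} {w} r on same
    with survivor-neighbour-not-adjacent s r on (≤-reflexive (cong κ same))
  ... | y , vy , on-y , wy = begin-strict
    κ (opposite (part v))        ≡⟨ cong κ y-side ⟨
    κ (part y)                   ≤⟨ alive-suc⇒k≤liveDeg s on-y ⟩
    liveDeg s y                  <⟨ liveDeg<liveIn-opposite s w-side (proj₁ r) y-w ⟩
    liveIn (opposite (part y)) s ≡⟨ cong (λ i → liveIn i s) (opposite-swap y-side) ⟨
    liveIn (part v) s            ∎
    where
      y-side = neighbour-opposite vy
      w-side = trans same (opposite-swap y-side)
      y-w = trans (Graph.sym G y w) wy
      open ≤-Reasoning

  setInactive-phase-bound : ∀ s {v} → setInactiveAt G k (suc (suc s)) v →
    suc s ≤ (P (part v) ∸ κ (opposite (part v))) + (P (opposite (part v)) ∸ κ (part v))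
  setInactive-phase-bound s {v} r with setInactive-suc⇒neighbour-setInactive (suc s) r
  ... | u , vu , r′ with setInactive-suc⇒neighbour-setInactive s r′
  ... | w , uw , r″ = m+[a+b]≤c+d⇒m≤[c∸a]+[d∸b] (suc s) counted
      (≤-trans (<⇒≤ lower-opp) (liveIn≤partSize i s))
      (≤-trans lower (liveIn≤partSize (opposite i) (suc s)))
    where
      i = part v
      w-side = trans (neighbour-opposite uw) (sym (opposite-swap (neighbour-opposite vu)))
      lower = κ≤liveIn-opposite (suc s) (proj₁ r)
      lower-opp = κ-opposite<liveIn s r″ (proj₁ r) w-side
      open ≤-Reasoning
      counted : suc s + (κ (opposite i) + κ i) ≤ P i + P (opposite i)
      counted = begin
        suc s + (κ (opposite i) + κ i)     ≡⟨ +-suc s _ ⟨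
        s + (suc (κ (opposite i)) + κ i)   ≤⟨ +-monoʳ-≤ s (+-mono-≤ lower-opp lower) ⟩
        s + potential i s                  ≡⟨ cong (λ j → s + potential j s) w-side ⟨
        s + potential (part w) s           ≤⟨ phase+potential≤n s r″ ⟩
        n                                  ≡⟨ partSize+partSize-opposite i ⟨
        P i + P (opposite i)               ∎

  convergesWithin-bipartite :
    ConvergesWithin G k (((P zero ∸ κ (suc zero)) + (P (suc zero) ∸ κ zero)) + 1)
  convergesWithin-bipartite = convergesWithin-of-¬setInactive (X + 1) quiet
    where
      X = (P zero ∸ κ (suc zero)) + (P (suc zero) ∸ κ zero)
      X-sides : ∀ i → (P i ∸ κ (opposite i)) + (P (opposite i) ∸ κ i) ≡ X
      X-sides zero       = refl
      X-sides (suc zero) = +-comm (P (suc zero) ∸ κ zero) _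
      quiet : ∀ t v → X + 1 < t → ¬ setInactiveAt G k t v
      quiet (suc zero)    v X<t r = <⇒≱ X<t (m≤n+m 1 X)
      quiet (suc (suc s)) v X<t r =
        <⇒≱ X<t (subst (_≤ X + 1) (+-comm (suc s) 1) (+-monoˡ-≤ 1 bound))
        where bound = subst (suc s ≤_) (X-sides (part v)) (setInactive-phase-bound s r)

lemma2 :
    (∀ {n} (G : Graph n) (k : ℕ) → k ≤ n → ConvergesWithin G (λ _ → k) (n ∸ k))
    × (∀ {n} (G : Graph n) (part : Fin n → Fin 2) → IsPartite G part → (k₁ k₂ : ℕ)
        → ConvergesWithin G (λ v → pair k₁ k₂ (part v))
            (((partSize part zero ∸ k₂) + (partSize part (suc zero) ∸ k₁)) + 1))
    × (∀ {n q} (G : Graph n) (part : Fin n → Fin (N.suc q)) → IsPartite G part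
        → (ks : Fin (N.suc q) → ℕ) → (∀ i → ks i ≤ partSize part i)
        → ConvergesWithin G (λ v → ks (part v)) (sumF (partSize part) ∸ minF ks))
lemma2 =
    (λ G k _ → Peeling.convergesWithin-n∸k G (λ _ → k) _ (λ _ → ≤-refl))
  , (λ G part bip k₁ k₂ → Bipartite.convergesWithin-bipartite G part bip (pair k₁ k₂))
  , λ G part _ ks _ → Peeling.convergesWithin-n∸k G (ks ∘ part) _ λ v →
      subst (λ m → m ∸ ks (part v) ≤ sumF (partSize part) ∸ minF ks) (sumF-partSize part)
        (∸-monoʳ-≤ _ (minF≤ ks (part v)))
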